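{- Let $A\subseteq\omega$ be $m$-rigid. Then there exist sets $B,C,D\subseteq\omega$, each many-one equivalent to $A$, such that: (1) $B\le_{bfin}A$ but $B\not\le_1 A$; (2) $C\le_{fin}A$ but $C\not\le_{bfin}A$; (3) $D\le_m A$ but $D\not\le_{fin}A$.
   Context: A set $A\subseteq\omega$ is $m$-rigid if for every total computable $f$ with $x\in A\iff f(x)\in A$ for all $x$, $f(x)=x$ for all but finitely many $x$. For $A,B\subseteq\omega$: $A\le_m B$ if there is a total computable $f$ with $x\in A\iff f(x)\in B$ for all $x$; $A\le_1B$ if this holds with $f$ injective; $A\le_{bfin}B$ if this holds with $f$ such that for some constant $c\ge1$, $|f^{ -1}(y)|\le c$ for all $y$; $A\le_{fin}B$ if this holds with $f$ finite-to-one ($|f^{ -1}(y)|<\infty$ for all $y$). $\equiv_m$ is mutual $\le_m$-reducibility. -}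

module Defs where

open import Data.Nat using (ℕ; zero; suc; _≤_; _<_)
open import Data.Fin using (Fin)
open import Data.Vec using (Vec; []; _∷_; lookup)
open import Data.List using (List; length)
open import Data.List.Relation.Unary.All using (All)
open import Data.List.Relation.Unary.Unique.Propositional using (Unique)
open import Data.Product using (Σ; _×_; ∃; ∃-syntax)
open import Function.Bundles using (_⇔_)
open import Relation.Binary.PropositionalEquality using (_≡_)
open import Relation.Nullary using (¬_)
open import Level using (0ℓ)

data PR : ℕ → Set where
  zeroF : ∀ {n} → PR n
  succF : PR 1
  proj  : ∀ {n} → Fin n → PR n
  comp  : ∀ {m n} → PR m → Vec (PR n) m → PR n
  prec  : ∀ {n} → PR n → PR (suc (suc n)) → PR (suc n)
  mu    : ∀ {n} → PR (suc n) → PR n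

mutual
  data Eval : ∀ {n} → PR n → Vec ℕ n → ℕ → Set where
    ev-zero : ∀ {n} {xs : Vec ℕ n} → Eval zeroF xs 0
    ev-succ : ∀ {x} → Eval succF (x ∷ []) (suc x)
    ev-proj : ∀ {n} {i : Fin n} {xs} → Eval (proj i) xs (lookup xs i)
    ev-comp : ∀ {m n} {f : PR m} {gs : Vec (PR n) m} {xs ys y} →
              EvalAll gs xs ys → Eval f ys y → Eval (comp f gs) xs y
    ev-prec0 : ∀ {n} {g : PR n} {h} {xs y} →
               Eval g xs y → Eval (prec g h) (0 ∷ xs) y
    ev-precS : ∀ {n} {g : PR n} {h} {xs k r y} →
               Eval (prec g h) (k ∷ xs) r → Eval h (k ∷ r ∷ xs) y →
               Eval (prec g h) (suc k ∷ xs) y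
    ev-mu : ∀ {n} {f : PR (suc n)} {xs k} →
            Eval f (k ∷ xs) 0 →
            (∀ j → j < k → ∃[ v ] Eval f (j ∷ xs) (suc v)) →
            Eval (mu f) xs k

  data EvalAll : ∀ {m n} → Vec (PR n) m → Vec ℕ n → Vec ℕ m → Set where
    []  : ∀ {n} {xs : Vec ℕ n} → EvalAll [] xs []
    _∷_ : ∀ {m n} {g : PR n} {gs : Vec (PR n) m} {xs y ys} →
          Eval g xs y → EvalAll gs xs ys → EvalAll (g ∷ gs) xs (y ∷ ys)

Computable : (ℕ → ℕ) → Set
Computable f = Σ (PR 1) λ e → ∀ x → Eval e (x ∷ []) (f x)

SetN : Set₁
SetN = ℕ → Set

Reduces : SetN → SetN → (ℕ → ℕ) → Set
Reduces A B f = ∀ x → A x ⇔ B (f x)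

InjectiveF : (ℕ → ℕ) → Set
InjectiveF f = ∀ x y → f x ≡ f y → x ≡ y

PreimageAtMost : (ℕ → ℕ) → ℕ → ℕ → Set
PreimageAtMost f c y = ∀ (xs : List ℕ) → Unique xs → All (λ x → f x ≡ y) xs → length xs ≤ c

BoundedFinToOne : (ℕ → ℕ) → Set
BoundedFinToOne f = ∃[ c ] (1 ≤ c × (∀ y → PreimageAtMost f c y))

FinToOne : (ℕ → ℕ) → Set
FinToOne f = ∀ y → ∃[ N ] (∀ x → f x ≡ y → x < N)

_≤m_ : SetN → SetN → Set
A ≤m B = ∃[ f ] (Computable f × Reduces A B f)

_≤1_ : SetN → SetN → Set
A ≤1 B = ∃[ f ] (Computable f × InjectiveF f × Reduces A B f)

_≤bfin_ : SetN → SetN → Set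
A ≤bfin B = ∃[ f ] (Computable f × BoundedFinToOne f × Reduces A B f)

_≤fin_ : SetN → SetN → Set
A ≤fin B = ∃[ f ] (Computable f × FinToOne f × Reduces A B f)

_≡m_ : SetN → SetN → Set
A ≡m B = (A ≤m B) × (B ≤m A)

MRigid : SetN → Set
MRigid A = ∀ f → Computable f → Reduces A A f → ∃[ N ] (∀ x → N ≤ x → f x ≡ x)

module Submission where

-- B, C and D are A ∘ h for computable h with a computable right inverse, so each is
-- m-equivalent to A, and h itself reduces it to A. If g reduces A ∘ h to A and s is a
-- computable section of h, then g ∘ s is a computable self-reduction of A, so rigidity
-- forces g (s x) = x for almost all x.
--
-- B = A ∘ ⌊_/2⌋: the sections 2x and 2x + 1 then make g non-injective.
-- C = A ∘ block, where block sends the k-th block [tri k, tri k + k] of ℕ to k: let s x be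
-- the first point of block x that g moves, or the last point if there is none. Once g fixes
-- s x, g maps the whole block x, of size x + 1, onto x, so no c bounds all fibres of g.
-- D = A ∘ offset, the position inside the block: every fibre of offset is infinite, so a
-- finite-to-one g moves some point of each fibre, and letting s x be such a point gives a
-- section along which g fixes nothing.

open import Defs
open import Data.Empty using (⊥; ⊥-elim)
open import Data.Fin using (Fin) renaming (zero to fz; suc to fs)
open import Data.List using ([]; _∷_; applyUpTo)
open import Data.List.Properties using (length-applyUpTo)
open import Data.List.Relation.Unary.All using ([]; _∷_)
import Data.List.Relation.Unary.All.Properties as All
open import Data.List.Relation.Unary.AllPairs using ([]; _∷_)
import Data.List.Relation.Unary.Unique.Propositional.Properties as Unique
open import Data.Nat
  using (ℕ; zero; suc; _+_; _∸_; pred; _≤_; _<_; z≤n; s≤s; _≟_; ≢-nonZero; ⌊_/2⌋; ⌈_/2⌉)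
open import Data.Nat.Induction using (<-rec)
open import Data.Nat.Properties
open import Data.Product using (Σ; _×_; _,_; proj₁; proj₂; ∃; ∃-syntax)
open import Data.Sum using (_⊎_; inj₁; inj₂)
open import Data.Vec using (Vec; []; _∷_; head; tail; lookup)
open import Data.Vec.N-ary using (_$ⁿ_)
open import Function using (_∘_)
open import Function.Bundles using (_⇔_; mk⇔; Equivalence)
open import Function.Properties.Equivalence using () renaming (refl to ⇔-refl; trans to ⇔-trans)
open import Relation.Binary.Definitions using (tri<; tri≈; tri>)
open import Relation.Binary.PropositionalEquality
open import Relation.Nullary using (¬_; yes; no)
open import Relation.Nullary.Decidable using (decidable-stable)
import Relation.Nullary.Decidable as Dec
open import Relation.Unary using (Decidable)

open Equivalence using (to; from)

Computableₙ : ∀ n → (Vec ℕ n → ℕ) → Set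
Computableₙ n F = Σ (PR n) λ e → ∀ xs → Eval e xs (F xs)

computableₙ-ext : ∀ {n F G} → Computableₙ n F → (∀ xs → F xs ≡ G xs) → Computableₙ n G
computableₙ-ext (e , eval) F≗G = e , λ xs → subst (Eval e xs) (F≗G xs) (eval xs)

computableₙ⇒computable : ∀ {F} → Computableₙ 1 F → Computable (λ x → F (x ∷ []))
computableₙ⇒computable (e , eval) = e , λ x → eval (x ∷ [])

computable⇒computableₙ : ∀ {f} → Computable f → Computableₙ 1 (f $ⁿ_)
computable⇒computableₙ (e , eval) = e , λ { (x ∷ []) → eval x }

zero-computable : ∀ {n} → Computableₙ n (λ _ → 0)
zero-computable = zeroF , λ _ → ev-zero

proj-computable : ∀ {n} (i : Fin n) → Computableₙ n (λ xs → lookup xs i)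
proj-computable i = proj i , λ _ → ev-proj

suc-computable : ∀ {n G} → Computableₙ n G → Computableₙ n (λ xs → suc (G xs))
suc-computable (g , evalG) = comp succF (g ∷ []) , λ xs → ev-comp (evalG xs ∷ []) ev-succ

∘₁-computable : ∀ {n F G} → Computableₙ 1 F → Computableₙ n G →
                Computableₙ n (λ xs → F (G xs ∷ []))
∘₁-computable (f , evalF) (g , evalG) =
  comp f (g ∷ []) , λ xs → ev-comp (evalG xs ∷ []) (evalF _)

∘₂-computable : ∀ {n F G H} → Computableₙ 2 F → Computableₙ n G → Computableₙ n H →
                Computableₙ n (λ xs → F (G xs ∷ H xs ∷ []))
∘₂-computable (f , evalF) (g , evalG) (h , evalH) =
  comp f (g ∷ h ∷ []) , λ xs → ev-comp (evalG xs ∷ evalH xs ∷ []) (evalF _)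

∘-computableₙ : ∀ {n f G} → Computable f → Computableₙ n G → Computableₙ n (λ xs → f (G xs))
∘-computableₙ cf = ∘₁-computable (computable⇒computableₙ cf)

∘-computable : ∀ {f g} → Computable f → Computable g → Computable (f ∘ g)
∘-computable cf cg = computableₙ⇒computable (∘-computableₙ cf (computable⇒computableₙ cg))

prec-computable : ∀ {n G H} (f : ℕ → Vec ℕ n → ℕ) →
                  Computableₙ n G → Computableₙ (suc (suc n)) H →
                  (∀ xs → f 0 xs ≡ G xs) → (∀ k xs → f (suc k) xs ≡ H (k ∷ f k xs ∷ xs)) →
                  Computableₙ (suc n) (λ xs → f (head xs) (tail xs))
prec-computable f (g , evalG) (h , evalH) f-zero f-suc =
  prec g h , λ { (k ∷ xs) → evalF k xs }
  where
  evalF : ∀ k xs → Eval (prec g h) (k ∷ xs) (f k xs)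
  evalF zero    xs = subst (Eval _ _) (sym (f-zero xs)) (ev-prec0 (evalG xs))
  evalF (suc k) xs = subst (Eval _ _) (sym (f-suc k xs)) (ev-precS (evalF k xs) (evalH _))

+-computable : Computableₙ 2 (_+_ $ⁿ_)
+-computable = computableₙ-ext
  (prec-computable (λ k xs → k + head xs) (proj-computable fz)
    (suc-computable (proj-computable (fs fz))) (λ { (_ ∷ []) → refl }) (λ _ _ → refl))
  λ { (_ ∷ _ ∷ []) → refl }

pred-computable : Computableₙ 1 (pred $ⁿ_)
pred-computable = computableₙ-ext
  (prec-computable (λ k _ → pred k) zero-computable (proj-computable fz)
    (λ _ → refl) (λ _ _ → refl))
  λ { (_ ∷ []) → refl }

∸-computable : Computableₙ 2 (_∸_ $ⁿ_)
∸-computable = computableₙ-ext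
  (∘₂-computable flipped-∸ (proj-computable (fs fz)) (proj-computable fz))
  λ { (_ ∷ _ ∷ []) → refl }
  where
  flipped-∸ : Computableₙ 2 (λ xs → head (tail xs) ∸ head xs)
  flipped-∸ = prec-computable (λ k xs → head xs ∸ k) (proj-computable fz)
    (∘₁-computable pred-computable (proj-computable (fs fz)))
    (λ { (_ ∷ []) → refl }) (λ { k (m ∷ []) → sym (pred[m∸n]≡m∸[1+n] m k) })

Least : (ℕ → Set) → ℕ → Set
Least P k = P k × (∀ j → j < k → ¬ P j)

least-witness : ∀ {P} → Decidable P → ∀ n → P n → ∃ (Least P)
least-witness {P} P? = <-rec _ search
  where
  search : ∀ n → (∀ {m} → m < n → P m → ∃ (Least P)) → P n → ∃ (Least P)
  search n smaller Pn with anyUpTo? P? n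
  ... | yes (m , m<n , Pm) = smaller m<n Pm
  ... | no ∄m<n            = n , Pn , λ j j<n Pj → ∄m<n (j , j<n , Pj)

-- The characteristic function χ takes the value 0 on members, since μ searches for zeros.
ComputablyDecidable : ∀ n → (Vec ℕ n → Set) → Set
ComputablyDecidable n P = ∃[ χ ] Computableₙ n χ × (∀ xs → χ xs ≡ 0 ⇔ P xs)

computablyDecidable-resp : ∀ {n P Q} → (∀ xs → P xs ⇔ Q xs) →
                           ComputablyDecidable n P → ComputablyDecidable n Q
computablyDecidable-resp P⇔Q (χ , cχ , spec) = χ , cχ , λ xs → ⇔-trans (spec xs) (P⇔Q xs)

≤-computablyDecidable : ∀ {n F G} → Computableₙ n F → Computableₙ n G →
                        ComputablyDecidable n (λ xs → F xs ≤ G xs)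
≤-computablyDecidable cF cG =
  _ , ∘₂-computable ∸-computable cF cG , λ _ → mk⇔ m∸n≡0⇒m≤n m≤n⇒m∸n≡0

×-computablyDecidable : ∀ {n P Q} → ComputablyDecidable n P → ComputablyDecidable n Q →
                        ComputablyDecidable n (λ xs → P xs × Q xs)
×-computablyDecidable (χ , cχ , specP) (ψ , cψ , specQ) =
  _ , ∘₂-computable +-computable cχ cψ ,
  λ xs → mk⇔ (λ χ+ψ≡0 → to (specP xs) (m+n≡0⇒m≡0 _ χ+ψ≡0) , to (specQ xs) (m+n≡0⇒n≡0 _ χ+ψ≡0))
             (λ (p , q) → cong₂ _+_ (from (specP xs) p) (from (specQ xs) q))

¬-computablyDecidable : ∀ {n P} → ComputablyDecidable n P →
                        ComputablyDecidable n (λ xs → ¬ P xs)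
¬-computablyDecidable (χ , cχ , spec) =
  _ , ∘₂-computable ∸-computable (suc-computable zero-computable) cχ ,
  λ xs → mk⇔ (λ 1∸χ≡0 p → 1+n≰n (subst (1 ≤_) (from (spec xs) p) (m∸n≡0⇒m≤n 1∸χ≡0)))
             (λ ¬p → m≤n⇒m∸n≡0 (n≢0⇒n>0 (¬p ∘ to (spec xs))))

≡-computablyDecidable : ∀ {n F G} → Computableₙ n F → Computableₙ n G →
                        ComputablyDecidable n (λ xs → F xs ≡ G xs)
≡-computablyDecidable cF cG =
  computablyDecidable-resp
    (λ _ → mk⇔ (λ (F≤G , G≤F) → ≤-antisym F≤G G≤F)
               (λ F≡G → ≤-reflexive F≡G , ≤-reflexive (sym F≡G)))
    (×-computablyDecidable (≤-computablyDecidable cF cG) (≤-computablyDecidable cG cF))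

μ-computable : ∀ {n P} → ComputablyDecidable (suc n) P → (∀ xs → ∃[ k ] P (k ∷ xs)) →
               ∃[ μP ] Computableₙ n μP × (∀ xs → Least (λ k → P (k ∷ xs)) (μP xs))
μ-computable {n} {P} (χ , (e , eval) , spec) witness =
  μP , (mu e , λ xs → evalμ xs (proj₂ (found xs))) , proj₂ ∘ found
  where
  found : ∀ xs → ∃ (Least (λ k → P (k ∷ xs)))
  found xs = least-witness (λ k → Dec.map (spec (k ∷ xs)) (χ (k ∷ xs) ≟ 0)) _ (proj₂ (witness xs))

  μP : Vec ℕ n → ℕ
  μP xs = proj₁ (found xs)

  evalμ : ∀ xs {k} → Least (λ k → P (k ∷ xs)) k → Eval (mu e) xs k
  evalμ xs (Pk , below) =
    ev-mu (subst (Eval e _) (from (spec _) Pk) (eval _))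
          (λ j j<k → let χ≢0 = below j j<k ∘ to (spec _) in
             pred (χ (j ∷ xs)) , subst (Eval e _) (sym (suc-pred _ {{≢-nonZero χ≢0}})) (eval _))

computable-least : {P : ℕ → ℕ → Set} → ComputablyDecidable 2 (P $ⁿ_) → (∀ x → ∃[ k ] P k x) →
                   ∃[ s ] Computable s × (∀ x → Least (λ k → P k x) (s x))
computable-least P-dec witness =
  let (μP , cμP , μP-least) = μ-computable P-dec (λ { (x ∷ []) → witness x })
  in  _ , computableₙ⇒computable cμP , λ x → μP-least (x ∷ [])

preimageAtMost-2 : ∀ {f y a b} → (∀ x → f x ≡ y → x ≡ a ⊎ x ≡ b) → PreimageAtMost f 2 y
preimageAtMost-2 _ []           _ _ = z≤n
preimageAtMost-2 _ (_ ∷ [])     _ _ = s≤s z≤n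
preimageAtMost-2 _ (_ ∷ _ ∷ []) _ _ = s≤s (s≤s z≤n)
preimageAtMost-2 among (u ∷ v ∷ w ∷ _) ((u≢v ∷ u≢w ∷ _) ∷ (v≢w ∷ _) ∷ _) (fu ∷ fv ∷ fw ∷ _) =
  ⊥-elim (pigeonhole (among u fu) (among v fv) (among w fw))
  where
  pigeonhole : ∀ {a b} → u ≡ a ⊎ u ≡ b → v ≡ a ⊎ v ≡ b → w ≡ a ⊎ w ≡ b → ⊥
  pigeonhole (inj₁ refl) (inj₁ refl) _ = u≢v refl
  pigeonhole (inj₂ refl) (inj₂ refl) _ = u≢v refl
  pigeonhole (inj₁ refl) _ (inj₁ refl) = u≢w refl
  pigeonhole (inj₂ refl) _ (inj₂ refl) = u≢w refl
  pigeonhole _ (inj₁ refl) (inj₁ refl) = v≢w refl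
  pigeonhole _ (inj₂ refl) (inj₂ refl) = v≢w refl

preimageAtMost-interval : ∀ {f c y a n} → PreimageAtMost f c y →
                          (∀ i → i ≤ n → f (a + i) ≡ y) → suc n ≤ c
preimageAtMost-interval {c = c} {a = a} {n} atMost interval =
  subst (_≤ c) (length-applyUpTo (a +_) (suc n))
    (atMost (applyUpTo (a +_) (suc n))
      (Unique.applyUpTo⁺₁ (a +_) (suc n) (λ i<j _ → <⇒≢ i<j ∘ +-cancelˡ-≡ a _ _))
      (All.applyUpTo⁺₁ (a +_) (suc n) (λ i<1+n → interval _ (≤-pred i<1+n))))

∘-reduces : (A : SetN) (h : ℕ → ℕ) → Reduces (A ∘ h) A h
∘-reduces _ _ _ = ⇔-refl

section-reduces : ∀ {A : SetN} {h s} → (∀ x → h (s x) ≡ x) → Reduces A (A ∘ h) s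
section-reduces {A} hs x = subst (λ y → A x ⇔ A y) (sym (hs x)) ⇔-refl

∘-≡m : ∀ {A h s} → Computable h → Computable s → (∀ x → h (s x) ≡ x) → (A ∘ h) ≡m A
∘-≡m {A} {h} {s} ch cs hs = (h , ch , ∘-reduces A h) , (s , cs , section-reduces {A} {h} hs)

BlockFibres : (h start : ℕ → ℕ) → Set
BlockFibres h start = ∀ x m → h m ≡ x ⇔ (start x ≤ m × m ≤ start x + x)

UnboundedFibres : (ℕ → ℕ) → Set
UnboundedFibres h = ∀ x N → ∃[ z ] N ≤ z × h z ≡ x

-- For block fibres, the least Stop point of h⁻¹(x) is the first point of the block that g
-- moves off x, or the last point of the block if g moves none of it.
Stop : (g h : ℕ → ℕ) → ℕ → ℕ → Set
Stop g h z x = h z ≡ x × ¬ (g z ≡ x × h (suc z) ≡ x)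

Moved : (g h : ℕ → ℕ) → ℕ → ℕ → Set
Moved g h z x = h z ≡ x × g z ≢ x

stop-computablyDecidable : ∀ {g h} → Computable g → Computable h →
                           ComputablyDecidable 2 (Stop g h $ⁿ_)
stop-computablyDecidable cg ch =
  computablyDecidable-resp (λ { (_ ∷ _ ∷ []) → ⇔-refl })
    (×-computablyDecidable (≡-computablyDecidable (∘-computableₙ ch z) x)
      (¬-computablyDecidable
        (×-computablyDecidable (≡-computablyDecidable (∘-computableₙ cg z) x)
                               (≡-computablyDecidable (∘-computableₙ ch (suc-computable z)) x))))
  where
  z : Computableₙ 2 (λ xs → lookup xs fz)
  z = proj-computable fz
  x : Computableₙ 2 (λ xs → lookup xs (fs fz))
  x = proj-computable (fs fz)

moved-computablyDecidable : ∀ {g h} → Computable g → Computable h →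
                            ComputablyDecidable 2 (Moved g h $ⁿ_)
moved-computablyDecidable cg ch =
  computablyDecidable-resp (λ { (_ ∷ _ ∷ []) → ⇔-refl })
    (×-computablyDecidable (≡-computablyDecidable (∘-computableₙ ch z) x)
      (¬-computablyDecidable (≡-computablyDecidable (∘-computableₙ cg z) x)))
  where
  z : Computableₙ 2 (λ xs → lookup xs fz)
  z = proj-computable fz
  x : Computableₙ 2 (λ xs → lookup xs (fs fz))
  x = proj-computable (fs fz)

unboundedFibres⇒moved : ∀ {g h} → FinToOne g → UnboundedFibres h → ∀ x → ∃[ z ] Moved g h z x
unboundedFibres⇒moved finite unbounded x =
  let (N , below) = finite x
      (z , N≤z , hz) = unbounded x N
  in  z , hz , λ gz → <⇒≱ (below z gz) N≤z

module _ {h start : ℕ → ℕ} (fibres : BlockFibres h start) where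

  blockFibres-section : ∀ x → h (start x) ≡ x
  blockFibres-section x = from (fibres x _) (≤-refl , m≤m+n _ x)

  blockFibres⇒finToOne : FinToOne h
  blockFibres⇒finToOne x = suc (start x + x) , λ m hm → s≤s (proj₂ (to (fibres x m) hm))

  last-stops : ∀ g x → Stop g h (start x + x) x
  last-stops g x = from (fibres x _) (m≤m+n _ x , ≤-refl) ,
                   λ (_ , h-next) → <-irrefl refl (proj₂ (to (fibres x _) h-next))

  leastStop-fixed⇒block⊆preimage : ∀ {g x z} → Least (λ z → Stop g h z x) z → g z ≡ x →
                                   ∀ i → i ≤ x → g (start x + i) ≡ x
  leastStop-fixed⇒block⊆preimage {g} {x} {z} ((hz , stop) , below) gz i i≤x
    with <-cmp (start x + i) z
  ... | tri< m<z _ _ = decidable-stable (g _ ≟ x) λ gm≢x →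
          below _ m<z (from (fibres x _) (m≤m+n _ i , +-monoʳ-≤ (start x) i≤x) , gm≢x ∘ proj₁)
  ... | tri≈ _ refl _ = gz
  ... | tri> _ _ z<m = ⊥-elim (stop (gz , from (fibres x (suc z))
          (m≤n⇒m≤1+n (proj₁ (to (fibres x z) hz)) , ≤-trans z<m (+-monoʳ-≤ (start x) i≤x))))

module _ {A : SetN} (rigid : MRigid A) {h : ℕ → ℕ} where

  section-eventually-fixed : ∀ {g s} → Computable g → Reduces (A ∘ h) A g → Computable s →
                             (∀ x → h (s x) ≡ x) → ∃[ N ] (∀ x → N ≤ x → g (s x) ≡ x)
  section-eventually-fixed {g} {s} cg g-reduces cs hs =
    rigid (g ∘ s) (∘-computable cg cs)
      (λ x → subst (λ y → A y ⇔ A (g (s x))) (hs x) (g-reduces (s x)))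

  disjointSections⇒≰1 : ∀ {s₁ s₂} → Computable s₁ → Computable s₂ →
                        (∀ x → h (s₁ x) ≡ x) → (∀ x → h (s₂ x) ≡ x) → (∀ x → s₁ x ≢ s₂ x) →
                        ¬ ((A ∘ h) ≤1 A)
  disjointSections⇒≰1 cs₁ cs₂ hs₁ hs₂ disjoint (g , cg , g-injective , g-reduces) =
    let (N₁ , fixed₁) = section-eventually-fixed cg g-reduces cs₁ hs₁
        (N₂ , fixed₂) = section-eventually-fixed cg g-reduces cs₂ hs₂
        x = N₁ + N₂
    in  disjoint x (g-injective _ _ (trans (fixed₁ x (m≤m+n N₁ N₂)) (sym (fixed₂ x (m≤n+m N₂ N₁)))))

  blockFibres⇒≰bfin : ∀ {start} → Computable h → BlockFibres h start → ¬ ((A ∘ h) ≤bfin A)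
  blockFibres⇒≰bfin {start} ch fibres (g , cg , (c , _ , atMost) , g-reduces) =
    collapse (computable-least (stop-computablyDecidable cg ch)
                               (λ x → start x + x , last-stops fibres g x))
    where
    collapse : (∃[ s ] Computable s × (∀ x → Least (λ z → Stop g h z x) (s x))) → ⊥
    collapse (s , cs , s-least) =
      let (N , fixed) = section-eventually-fixed cg g-reduces cs (λ x → proj₁ (proj₁ (s-least x)))
          block⊆preimage = leastStop-fixed⇒block⊆preimage fibres (s-least (N + c))
                                                         (fixed (N + c) (m≤m+n N c))
      in  <-irrefl refl (≤-trans (preimageAtMost-interval (atMost (N + c)) block⊆preimage)
                                 (m≤n+m c N))

  unboundedFibres⇒≰fin : Computable h → UnboundedFibres h → ¬ ((A ∘ h) ≤fin A)
  unboundedFibres⇒≰fin ch unbounded (g , cg , finite , g-reduces) =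
    collapse (computable-least (moved-computablyDecidable cg ch)
                               (unboundedFibres⇒moved finite unbounded))
    where
    collapse : (∃[ s ] Computable s × (∀ x → Least (λ z → Moved g h z x) (s x))) → ⊥
    collapse (s , cs , s-least) =
      let (N , fixed) = section-eventually-fixed cg g-reduces cs (λ x → proj₁ (proj₁ (s-least x)))
      in  proj₂ (proj₁ (s-least N)) (fixed N ≤-refl)

⌊/2⌋-computable : Computable ⌊_/2⌋
⌊/2⌋-computable = computableₙ⇒computable
  (prec-computable (λ k _ → ⌊ k /2⌋) zero-computable
    (∘₂-computable ∸-computable (proj-computable fz) (proj-computable (fs fz)))
    (λ _ → refl) (λ k _ → ⌈n/2⌉≡n∸⌊n/2⌋ k))
  where
  ⌈n/2⌉≡n∸⌊n/2⌋ : ∀ n → ⌈ n /2⌉ ≡ n ∸ ⌊ n /2⌋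
  ⌈n/2⌉≡n∸⌊n/2⌋ n = trans (sym (m+n∸m≡n ⌊ n /2⌋ ⌈ n /2⌉)) (cong (_∸ ⌊ n /2⌋) (⌊n/2⌋+⌈n/2⌉≡n n))

⌊/2⌋-preimage : ∀ m y → ⌊ m /2⌋ ≡ y → m ≡ y + y ⊎ m ≡ suc (y + y)
⌊/2⌋-preimage zero          _ refl = inj₁ refl
⌊/2⌋-preimage (suc zero)    _ refl = inj₂ refl
⌊/2⌋-preimage (suc (suc m)) _ refl with ⌊/2⌋-preimage m ⌊ m /2⌋ refl
... | inj₁ m≡h+h   = inj₁ (cong suc (trans (cong suc m≡h+h) (sym (+-suc ⌊ m /2⌋ ⌊ m /2⌋))))
... | inj₂ m≡1+h+h = inj₂ (cong (suc ∘ suc) (trans m≡1+h+h (sym (+-suc ⌊ m /2⌋ ⌊ m /2⌋))))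

⌊/2⌋-atMost2 : ∀ y → PreimageAtMost ⌊_/2⌋ 2 y
⌊/2⌋-atMost2 y = preimageAtMost-2 (λ m → ⌊/2⌋-preimage m y)

⌊2n/2⌋≡n : ∀ n → ⌊ n + n /2⌋ ≡ n
⌊2n/2⌋≡n n = sym (n≡⌊n+n/2⌋ n)

⌊1+2n/2⌋≡n : ∀ n → ⌊ suc (n + n) /2⌋ ≡ n
⌊1+2n/2⌋≡n n = sym (n≡⌈n+n/2⌉ n)

double-computable : Computable (λ x → x + x)
double-computable =
  computableₙ⇒computable (∘₂-computable +-computable (proj-computable fz) (proj-computable fz))

double+1-computable : Computable (λ x → suc (x + x))
double+1-computable = computableₙ⇒computable
  (suc-computable (∘₂-computable +-computable (proj-computable fz) (proj-computable fz)))

tri : ℕ → ℕ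
tri zero    = 0
tri (suc n) = tri n + suc n

tri-computable : Computable tri
tri-computable = computableₙ⇒computable
  (prec-computable (λ k _ → tri k) zero-computable
    (∘₂-computable +-computable (proj-computable (fs fz)) (suc-computable (proj-computable fz)))
    (λ _ → refl) (λ _ _ → refl))

tri+id-computable : Computable (λ x → tri x + x)
tri+id-computable = computableₙ⇒computable
  (∘₂-computable +-computable (∘-computableₙ tri-computable (proj-computable fz))
                              (proj-computable fz))

n≤tri[n] : ∀ n → n ≤ tri n
n≤tri[n] zero    = z≤n
n≤tri[n] (suc n) = m≤n+m (suc n) (tri n)

tri-mono-≤ : ∀ {m n} → m ≤ n → tri m ≤ tri n
tri-mono-≤ z≤n       = z≤n
tri-mono-≤ (s≤s m≤n) = +-mono-≤ (tri-mono-≤ m≤n) (s≤s m≤n)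

tri[n]+n<tri[1+n] : ∀ n → tri n + n < tri (suc n)
tri[n]+n<tri[1+n] n = ≤-reflexive (sym (+-suc (tri n) n))

blockSearch : ∃[ b ] Computable b × (∀ m → Least (λ k → m ≤ tri k + k) (b m))
blockSearch = computable-least
  (computablyDecidable-resp (λ { (_ ∷ _ ∷ []) → ⇔-refl })
    (≤-computablyDecidable (proj-computable (fs fz))
      (∘₂-computable +-computable (∘-computableₙ tri-computable (proj-computable fz))
                                  (proj-computable fz))))
  (λ m → m , m≤n+m m (tri m))

block : ℕ → ℕ
block = proj₁ blockSearch

block-computable : Computable block
block-computable = proj₁ (proj₂ blockSearch)

block-least : ∀ m → Least (λ k → m ≤ tri k + k) (block m)
block-least = proj₂ (proj₂ blockSearch)

tri[block[m]]≤m : ∀ m → tri (block m) ≤ m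
tri[block[m]]≤m m = lower-bound (block m) (block-least m)
  where
  lower-bound : ∀ k → Least (λ k → m ≤ tri k + k) k → tri k ≤ m
  lower-bound zero    _           = z≤n
  lower-bound (suc k) (_ , below) =
    ≤-trans (≤-reflexive (+-suc (tri k) k)) (≰⇒> (below k (n<1+n k)))

block-fibres : BlockFibres block tri
block-fibres x m = mk⇔ (λ { refl → tri[block[m]]≤m m , proj₁ (block-least m) }) in-block
  where
  in-block : tri x ≤ m × m ≤ tri x + x → block m ≡ x
  in-block (tri[x]≤m , m≤end) with <-cmp (block m) x
  ... | tri< k<x _ _ = ⊥-elim (1+n≰n (begin
          suc m                         ≤⟨ s≤s (proj₁ (block-least m)) ⟩
          suc (tri (block m) + block m) ≤⟨ tri[n]+n<tri[1+n] (block m) ⟩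
          tri (suc (block m))           ≤⟨ tri-mono-≤ k<x ⟩
          tri x                         ≤⟨ tri[x]≤m ⟩
          m                             ∎))
    where open ≤-Reasoning
  ... | tri≈ _ k≡x _ = k≡x
  ... | tri> _ _ x<k = ⊥-elim (proj₂ (block-least m) x x<k m≤end)

offset : ℕ → ℕ
offset z = z ∸ tri (block z)

offset-computable : Computable offset
offset-computable = computableₙ⇒computable
  (∘₂-computable ∸-computable (proj-computable fz)
    (∘-computableₙ (∘-computable tri-computable block-computable) (proj-computable fz)))

offset[tri[k]+x]≡x : ∀ k {x} → x ≤ k → offset (tri k + x) ≡ x
offset[tri[k]+x]≡x k {x} x≤k = begin
  tri k + x ∸ tri (block (tri k + x)) ≡⟨ cong (λ b → tri k + x ∸ tri b) block≡k ⟩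
  tri k + x ∸ tri k                   ≡⟨ m+n∸m≡n (tri k) x ⟩
  x                                   ∎
  where
  open ≡-Reasoning
  block≡k : block (tri k + x) ≡ k
  block≡k = from (block-fibres k _) (m≤m+n (tri k) x , +-monoʳ-≤ (tri k) x≤k)

offset-unbounded : UnboundedFibres offset
offset-unbounded x N = tri (x + N) + x , N≤ , offset[tri[k]+x]≡x (x + N) (m≤m+n x N)
  where
  N≤ : N ≤ tri (x + N) + x
  N≤ = ≤-trans (m≤n+m N x) (≤-trans (n≤tri[n] (x + N)) (m≤m+n (tri (x + N)) x))

proposition4p5 : (A : SetN) → MRigid A →
    Σ SetN λ B → Σ SetN λ C → Σ SetN λ D →
      (B ≡m A) × (C ≡m A) × (D ≡m A) ×
      ((B ≤bfin A) × ¬ (B ≤1 A)) ×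
      ((C ≤fin A) × ¬ (C ≤bfin A)) ×
      ((D ≤m A) × ¬ (D ≤fin A))
proposition4p5 A rigid =
  A ∘ ⌊_/2⌋ , A ∘ block , A ∘ offset ,
  ∘-≡m ⌊/2⌋-computable double-computable ⌊2n/2⌋≡n ,
  ∘-≡m block-computable tri-computable (blockFibres-section block-fibres) ,
  ∘-≡m offset-computable tri+id-computable (λ x → offset[tri[k]+x]≡x x ≤-refl) ,
  ((⌊_/2⌋ , ⌊/2⌋-computable , (2 , s≤s z≤n , ⌊/2⌋-atMost2) , ∘-reduces A ⌊_/2⌋) ,
   disjointSections⇒≰1 rigid double-computable double+1-computable ⌊2n/2⌋≡n ⌊1+2n/2⌋≡n
     (λ x → <⇒≢ (n<1+n (x + x)))) ,
  ((block , block-computable , blockFibres⇒finToOne block-fibres , ∘-reduces A block) ,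
   blockFibres⇒≰bfin rigid block-computable block-fibres) ,
  ((offset , offset-computable , ∘-reduces A offset) ,
   unboundedFibres⇒≰fin rigid offset-computable offset-unbounded)
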